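{- Under the action of the group $G = \{\mathrm{id}, \phi\}$ on odd encodings, every orbit has size exactly $2$; equivalently, $\phi(\alpha) \neq \alpha$ for every odd encoding $\alpha$.
   Context: For a vector $\vec b = [b_0, \ldots, b_{2n}]$ of non-negative integers, an odd encoding is a tuple $(\vec b; s, l; t, m)$ of integers with $0 \leq s < t \leq 2n$, $s$ and $t$ of different parity, $0 \leq l < 2(b_s+1)$, $0 \leq m < 2(b_t+1)$, and $l$ and $m$ of different parity. The map $\phi$ is $\phi(\vec b; s, l; t, m) = (\vec c; s, m; t, l)$, where $c_i = b_i$ for $i < s$ or $i > t$ and $c_i = b_{s+t-i}$ for $s \leq i \leq t$; it maps odd encodings to odd encodings and satisfies $\phi^2 = \mathrm{id}$, so $G=\{\mathrm{id},\phi\}$ acts on odd encodings. -}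

module Defs where

open import Data.Nat using (ℕ; suc; _+_; _*_; _∸_; _≤_; _<_; _≤ᵇ_)
open import Data.Nat using (_<?_)
open import Relation.Nullary using (yes; no)
open import Data.Nat.DivMod using (_%_)
open import Data.Fin using (Fin; toℕ; fromℕ<)
open import Data.Bool using (Bool; if_then_else_; _∧_)
open import Data.Product using (_×_; _,_)
open import Relation.Binary.PropositionalEquality using (_≡_; _≢_)

Idx : ℕ → Set
Idx n = Fin (suc (2 * n))

Vector : ℕ → Set
Vector n = Idx n → ℕ

record Tuple (n : ℕ) : Set where
  constructor ⟨_⨾_,_⨾_,_⟩
  field
    b : Vector n
    s : Idx n
    l : ℕ
    t : Idx n
    m : ℕ
open Tuple public

DiffParity : ℕ → ℕ → Set
DiffParity x y = (x + y) % 2 ≡ 1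

record IsOddEncoding {n : ℕ} (α : Tuple n) : Set where
  field
    s<t    : toℕ (s α) < toℕ (t α)
    st-par : DiffParity (toℕ (s α)) (toℕ (t α))
    l<     : l α < 2 * (b α (s α) + 1)
    m<     : m α < 2 * (b α (t α) + 1)
    lm-par : DiffParity (l α) (m α)

-- s + t - i is a valid index whenever s ≤ i ≤ t (then s + t - i ≤ t ≤ 2n);
-- outside that range we never use it, so we clamp with a fallback.
reflectIdx : {n : ℕ} → Idx n → Idx n → Idx n → Idx n
reflectIdx {n} s t i with (toℕ s + toℕ t ∸ toℕ i) <? suc (2 * n)
... | yes p = fromℕ< p
... | no _ = i

reflectVec : {n : ℕ} → Idx n → Idx n → Vector n → Vector n
reflectVec {n} s t b i =
  if (toℕ s ≤ᵇ toℕ i) ∧ (toℕ i ≤ᵇ toℕ t)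
  then b (reflectIdx {n} s t i)
  else b i

φ : {n : ℕ} → Tuple n → Tuple n
φ {n} α = ⟨ reflectVec {n} (s α) (t α) (b α) ⨾ s α , m α ⨾ t α , l α ⟩

-- φ keeps s and t but exchanges the labels l and m, so a fixed point would have
-- l = m; then l + m = 2l is even, contradicting that l and m differ in parity.
module Submission where

open import Defs
open import Data.Nat using (ℕ; _+_; _*_)
open import Data.Nat.DivMod using (_%_; m*n%n≡0)
open import Data.Nat.Properties using (*-comm; +-identityʳ; 0≢1+n)
open import Relation.Nullary using (¬_)
open import Relation.Binary.PropositionalEquality
  using (_≡_; _≢_; cong; sym; trans; subst; module ≡-Reasoning)

m+m%2≡0 : ∀ m → (m + m) % 2 ≡ 0
m+m%2≡0 m = begin
  (m + m) % 2  ≡⟨ cong (λ k → (m + k) % 2) (sym (+-identityʳ m)) ⟩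
  (2 * m) % 2  ≡⟨ cong (_% 2) (*-comm 2 m) ⟩
  (m * 2) % 2  ≡⟨ m*n%n≡0 m 2 ⟩
  0            ∎
  where open ≡-Reasoning

¬DiffParity-refl : ∀ x → ¬ DiffParity x x
¬DiffParity-refl x odd = 0≢1+n (trans (sym (m+m%2≡0 x)) odd)

φ-fixed⇒l≡m : ∀ {n} {α : Tuple n} → φ α ≡ α → l α ≡ m α
φ-fixed⇒l≡m φα≡α = cong m φα≡α

mainTheorem11 : (n : ℕ) (α : Tuple n) → IsOddEncoding α → φ α ≢ α
mainTheorem11 n α enc φα≡α =
  ¬DiffParity-refl (l α)
    (subst (DiffParity (l α)) (sym (φ-fixed⇒l≡m φα≡α)) (IsOddEncoding.lm-par enc))
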